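{- Let $G$ be a nontrivial connected graph of order $n$ with girth $g\ge 6$, minimum degree $\delta\ge 2$ and maximum degree $\Delta$. Then $\gamma_{tR2}(G)\le n+2-(\Delta+\delta)$.
   Context: All graphs are finite and simple. For $f:V(G)\to\{0,1,2\}$ let $V_i=\{v:f(v)=i\}$; $f$ is a total Roman $\{2\}$-dominating function (TR2DF) if every vertex $v$ with $f(v)=0$ has a neighbor $u$ with $f(u)=2$ or two distinct neighbors $x,y$ with $f(x)=f(y)=1$, and the subgraph induced by $V_1\cup V_2$ has no isolated vertices. $\gamma_{tR2}(G)$ is the minimum weight $\sum_v f(v)$ of a TR2DF of $G$. -}

module Defs where

open import Data.Nat using (ℕ; zero; suc; _+_; _≤_)
open import Data.Fin using (Fin; toℕ; inject₁; fromℕ) renaming (zero to fzero; suc to fsuc)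
open import Data.Bool using (Bool; true; false; if_then_else_)
open import Data.List using (List; map; allFin)
open import Data.Nat.ListAction using (sum)
open import Data.Product using (Σ; ∃; ∃-syntax; _×_; _,_)
open import Data.Sum using (_⊎_)
open import Relation.Binary.PropositionalEquality using (_≡_; _≢_)
open import Function.Definitions using (Injective)

record Graph (n : ℕ) : Set where
  field
    E      : Fin n → Fin n → Bool
    sym    : ∀ u v → E u v ≡ E v u
    irrefl : ∀ v → E v v ≡ false

module _ {n : ℕ} (G : Graph n) where
  open Graph G

  Adj : Fin n → Fin n → Set
  Adj u v = E u v ≡ true

  deg : Fin n → ℕ
  deg v = sum (map (λ u → if E v u then 1 else 0) (allFin n))

  IsMinDegree : ℕ → Set
  IsMinDegree δ = (∃[ v ] deg v ≡ δ) × (∀ v → δ ≤ deg v)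

  IsMaxDegree : ℕ → Set
  IsMaxDegree Δ = (∃[ v ] deg v ≡ Δ) × (∀ v → deg v ≤ Δ)

  data Walk : Fin n → Fin n → ℕ → Set where
    here : ∀ {u} → Walk u u 0
    step : ∀ {u w v k} → Adj u w → Walk w v k → Walk u v (suc k)

  Connected : Set
  Connected = ∀ u v → ∃[ k ] Walk u v k

  record Cycle (m : ℕ) : Set where
    field
      c       : Fin (suc m) → Fin n
      len≥3   : 3 ≤ suc m
      inj     : Injective _≡_ _≡_ c
      consec  : ∀ (i : Fin m) → Adj (c (inject₁ i)) (c (fsuc i))
      closing : Adj (c (fromℕ m)) (c fzero)

  -- girth ≥ g : every cycle has length ≥ g (vacuous for acyclic graphs,
  -- whose girth is ∞)
  GirthAtLeast : ℕ → Set
  GirthAtLeast g = ∀ m → Cycle m → g ≤ suc m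

  -- Total Roman {2}-dominating function, values in {0,1,2} = Fin 3
  IsTR2DF : (Fin n → Fin 3) → Set
  IsTR2DF f =
    (∀ v → f v ≡ fzero →
       (∃[ u ] (Adj v u × f u ≡ fsuc (fsuc fzero)))
       ⊎ (∃[ x ] ∃[ y ] (x ≢ y × Adj v x × Adj v y
                          × f x ≡ fsuc fzero × f y ≡ fsuc fzero)))
    × (∀ v → f v ≢ fzero → ∃[ u ] (Adj v u × f u ≢ fzero))

  weight : (Fin n → Fin 3) → ℕ
  weight f = sum (map (λ v → toℕ (f v)) (allFin n))

  -- γ_tR2(G) ≤ b  ⟺  some TR2DF has weight ≤ b
  γtR2≤ : ℕ → Set
  γtR2≤ b = Σ (Fin n → Fin 3) λ f → IsTR2DF f × weight f ≤ b

-- Take a vertex v of degree Δ and a neighbour u, label N(v) ∪ N(u) ∖ {u, v} with 0 and every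
-- other vertex with 1. Without triangles N(v) and N(u) are disjoint, so the weight is
-- n − (Δ − 1) − (deg u − 1) ≤ n + 2 − Δ − δ. A 0-vertex x ∈ N(v) sees v and, as δ ≥ 2, another
-- neighbour w, which is labelled 1 because otherwise v x w or v x w u would be a short cycle
-- (symmetrically for N(u)). A 1-vertex other than u, v has at least two neighbours, and two of
-- them labelled 0 would close a 4- or 5-cycle; u and v are each other's 1-neighbours.
module Submission where

open import Defs
open import Data.Bool using (Bool; true; false; not; _∧_; _∨_; if_then_else_)
open import Data.Bool.Properties using (¬-not)
open import Data.Empty using (⊥; ⊥-elim)
open import Data.Fin using (Fin; toℕ; inject₁; fromℕ; _≟_) renaming (zero to fzero; suc to fsuc)
open import Data.Fin.Properties using (¬∀⟶∃¬)
open import Data.List using (List; []; _∷_; length; lookup; map; allFin)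
open import Data.List.Membership.Propositional.Properties using (∈-lookup)
open import Data.List.Properties using (map-cong; map-tabulate)
open import Data.List.Relation.Unary.All as All using ([]; _∷_)
open import Data.List.Relation.Unary.AllPairs using ([]; _∷_)
open import Data.List.Relation.Unary.Linked using (Linked; [-]; _∷_)
open import Data.List.Relation.Unary.Unique.Propositional using (Unique)
open import Data.Nat using (ℕ; zero; suc; _+_; _*_; _≤_; _<_; _∸_; s≤s; z≤n; _≤?_)
open import Data.Nat.ListAction using (sum)
open import Data.Nat.Properties hiding (_≟_)
open import Algebra.Properties.CommutativeSemigroup +-commutativeSemigroup using (interchange)
open import Data.Product using (∃-syntax; _×_; _,_)
open import Data.Sum as Sum using (_⊎_; inj₁; inj₂)
open import Function using (_∘_)
open import Function.Definitions using (Injective)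
open import Relation.Nullary using (¬_; Dec; yes; no; does; contradiction)
open import Relation.Nullary.Decidable using (dec-true)
open import Relation.Binary.PropositionalEquality

module _ {a} {A : Set a} where

  Unique-lookup-injective : {xs : List A} → Unique xs → Injective _≡_ _≡_ (lookup xs)
  Unique-lookup-injective (_ ∷ _) {fzero} {fzero} _ = refl
  Unique-lookup-injective (x∉ ∷ _) {fzero} {fsuc j} x≡xⱼ = ⊥-elim (All.lookup x∉ (∈-lookup j) x≡xⱼ)
  Unique-lookup-injective (x∉ ∷ _) {fsuc i} {fzero} xᵢ≡x = ⊥-elim (All.lookup x∉ (∈-lookup i) (sym xᵢ≡x))
  Unique-lookup-injective (_ ∷ xs!) {fsuc i} {fsuc j} xᵢ≡xⱼ = cong fsuc (Unique-lookup-injective xs! xᵢ≡xⱼ)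

  Linked-consecutive : ∀ {ℓ} {R : A → A → Set ℓ} {x : A} {xs : List A} → Linked R (x ∷ xs) →
                       ∀ i → R (lookup (x ∷ xs) (inject₁ i)) (lookup (x ∷ xs) (fsuc i))
  Linked-consecutive (r ∷ _) fzero = r
  Linked-consecutive (_ ∷ rs) (fsuc i) = Linked-consecutive rs i

does≡false⇒¬ : ∀ {p} {P : Set p} (P? : Dec P) → does P? ≡ false → ¬ P
does≡false⇒¬ P? ≡false p = contradiction (trans (sym (dec-true P? p)) ≡false) λ ()

⟦_⟧ : Bool → ℕ
⟦ b ⟧ = if b then 1 else 0

module _ {n : ℕ} where

  ∑ : (Fin n → ℕ) → ℕ
  ∑ h = sum (map h (allFin n))

  ∑-cong : {g h : Fin n → ℕ} → (∀ x → g x ≡ h x) → ∑ g ≡ ∑ h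
  ∑-cong g≗h = cong sum (map-cong g≗h (allFin n))

∑-suc : ∀ {n} (h : Fin (suc n) → ℕ) → ∑ h ≡ h fzero + ∑ (h ∘ fsuc)
∑-suc {n} h = cong (λ hs → h fzero + sum hs)
  (trans (map-tabulate fsuc h) (sym (map-tabulate (λ x → x) (h ∘ fsuc))))

∑-+ : ∀ {n} (g h : Fin n → ℕ) → ∑ (λ x → g x + h x) ≡ ∑ g + ∑ h
∑-+ {zero} g h = refl
∑-+ {suc n} g h = begin
  ∑ (λ x → g x + h x)
    ≡⟨ ∑-suc (λ x → g x + h x) ⟩
  g fzero + h fzero + ∑ (λ x → g (fsuc x) + h (fsuc x))
    ≡⟨ cong (g fzero + h fzero +_) (∑-+ (g ∘ fsuc) (h ∘ fsuc)) ⟩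
  g fzero + h fzero + (∑ (g ∘ fsuc) + ∑ (h ∘ fsuc))
    ≡⟨ interchange (g fzero) (h fzero) _ _ ⟩
  g fzero + ∑ (g ∘ fsuc) + (h fzero + ∑ (h ∘ fsuc))
    ≡⟨ sym (cong₂ _+_ (∑-suc g) (∑-suc h)) ⟩
  ∑ g + ∑ h ∎
  where open ≡-Reasoning

∑-+-+ : ∀ {n} (f g h : Fin n → ℕ) → ∑ (λ x → f x + g x + h x) ≡ ∑ f + ∑ g + ∑ h
∑-+-+ f g h = trans (∑-+ (λ x → f x + g x) h) (cong (_+ ∑ h) (∑-+ f g))

∑-const : ∀ n c → ∑ {n} (λ _ → c) ≡ n * c
∑-const zero c = refl
∑-const (suc n) c = trans (∑-suc {n} (λ _ → c)) (cong (c +_) (∑-const n c))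

∑-mono-≤ : ∀ {n} {g h : Fin n → ℕ} → (∀ x → g x ≤ h x) → ∑ g ≤ ∑ h
∑-mono-≤ {zero} g≤h = ≤-refl
∑-mono-≤ {suc n} {g} {h} g≤h = begin
  ∑ g                     ≡⟨ ∑-suc g ⟩
  g fzero + ∑ (g ∘ fsuc)  ≤⟨ +-mono-≤ (g≤h fzero) (∑-mono-≤ (g≤h ∘ fsuc)) ⟩
  h fzero + ∑ (h ∘ fsuc)  ≡⟨ sym (∑-suc h) ⟩
  ∑ h                     ∎
  where open ≤-Reasoning

∑-<⇒∃< : ∀ {n} {g h : Fin n → ℕ} → ∑ g < ∑ h → ∃[ x ] g x < h x
∑-<⇒∃< {n} {g} {h} ∑g<∑h with ¬∀⟶∃¬ n (λ x → h x ≤ g x) (λ x → h x ≤? g x) (<⇒≱ ∑g<∑h ∘ ∑-mono-≤)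
... | x , hx≰gx = x , ≰⇒> hx≰gx

∑-δ : ∀ {n} (v : Fin n) → ∑ (λ x → ⟦ does (x ≟ v) ⟧) ≡ 1
∑-δ {suc n} fzero =
  trans (∑-suc {n} (λ x → ⟦ does (x ≟ fzero) ⟧)) (cong suc (trans (∑-const n 0) (*-zeroʳ n)))
∑-δ {suc n} (fsuc v) = trans (∑-suc {n} (λ x → ⟦ does (x ≟ fsuc v) ⟧)) (∑-δ v)

χᶜ : Bool → Fin 3
χᶜ true  = fzero
χᶜ false = fsuc fzero

χᶜ≡0⇒true : ∀ {b} → χᶜ b ≡ fzero → b ≡ true
χᶜ≡0⇒true {true} _ = refl

module _ {n : ℕ} (G : Graph n) where

  Adj-sym : ∀ {x y} → Adj G x y → Adj G y x
  Adj-sym {x} {y} xy = trans (Graph.sym G y x) xy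

  Adj⇒≢ : ∀ {x y} → Adj G x y → x ≢ y
  Adj⇒≢ {x} xx refl = contradiction (trans (sym xx) (Graph.irrefl G x)) λ ()

  EdgeNeighbour : Fin n → Fin n → Fin n → Set
  EdgeNeighbour p q x = (Adj G p x × x ≢ q) ⊎ (Adj G q x × x ≢ p)

  another-neighbour : ∀ x y → 2 ≤ deg G x → ∃[ z ] (z ≢ y × Adj G x z)
  another-neighbour x y 2≤deg
    with ∑-<⇒∃< {g = λ z → ⟦ does (z ≟ y) ⟧} {h = λ z → ⟦ Graph.E G x z ⟧}
                (subst (_≤ deg G x) (cong suc (sym (∑-δ y))) 2≤deg)
  ... | z , lt with Graph.E G x z in xz | z ≟ y
  ...   | true  | no z≢y = z , z≢y , xz
  ...   | true  | yes _  = ⊥-elim (<-irrefl refl lt)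
  ...   | false | _      = ⊥-elim (n≮0 lt)

  χᶜ-isTR2DF : (S : Fin n → Bool) →
    (∀ x → S x ≡ true → ∃[ a ] ∃[ b ] (a ≢ b × Adj G x a × Adj G x b × S a ≡ false × S b ≡ false)) →
    (∀ x → S x ≡ false → ∃[ y ] (Adj G x y × S y ≡ false)) →
    IsTR2DF G (χᶜ ∘ S)
  χᶜ-isTR2DF S two-outside one-outside =
    (λ x fx≡0 →
      let a , b , a≢b , xa , xb , sa , sb = two-outside x (χᶜ≡0⇒true fx≡0)
      in inj₂ (a , b , a≢b , xa , xb , cong χᶜ sa , cong χᶜ sb)) ,
    (λ x fx≢0 →
      let y , xy , sy = one-outside x (¬-not (fx≢0 ∘ cong χᶜ))
      in y , xy , λ fy≡0 → contradiction (trans (cong χᶜ (sym sy)) fy≡0) λ ())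

  cycle : (x : Fin n) (xs : List (Fin n)) → 2 ≤ length xs → Unique (x ∷ xs) →
          Linked (Adj G) (x ∷ xs) → Adj G (lookup (x ∷ xs) (fromℕ (length xs))) x →
          Cycle G (length xs)
  cycle x xs 2≤len distinct path closing = record
    { c       = lookup (x ∷ xs)
    ; len≥3   = s≤s 2≤len
    ; inj     = Unique-lookup-injective distinct
    ; consec  = Linked-consecutive path
    ; closing = closing
    }

  module _ {g : ℕ} (girth : GirthAtLeast G g) where

    no-triangle : 4 ≤ g → ∀ {a b c} → Adj G a b → Adj G b c → Adj G c a → ⊥
    no-triangle 4≤g {a} {b} {c} ab bc ca =
      <⇒≱ 4≤g (girth 2 (cycle a (b ∷ c ∷ []) ≤-refl distinct (ab ∷ bc ∷ [-]) ca))
      where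
      distinct : Unique (a ∷ b ∷ c ∷ [])
      distinct = (Adj⇒≢ ab ∷ (Adj⇒≢ ca ∘ sym) ∷ []) ∷ (Adj⇒≢ bc ∷ []) ∷ [] ∷ []

    no-square : 5 ≤ g → ∀ {a b c d} → a ≢ c → b ≢ d →
                Adj G a b → Adj G b c → Adj G c d → Adj G d a → ⊥
    no-square 5≤g {a} {b} {c} {d} a≢c b≢d ab bc cd da =
      <⇒≱ 5≤g (girth 3 (cycle a (b ∷ c ∷ d ∷ []) (s≤s (s≤s z≤n)) distinct (ab ∷ bc ∷ cd ∷ [-]) da))
      where
      distinct : Unique (a ∷ b ∷ c ∷ d ∷ [])
      distinct = (Adj⇒≢ ab ∷ a≢c ∷ (Adj⇒≢ da ∘ sym) ∷ [])
               ∷ (Adj⇒≢ bc ∷ b≢d ∷ [])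
               ∷ (Adj⇒≢ cd ∷ [])
               ∷ [] ∷ []

    -- Distinctness of the five vertices comes for free: a coincidence would close a triangle.
    no-pentagon : 6 ≤ g → ∀ {a b c d e} →
                  Adj G a b → Adj G b c → Adj G c d → Adj G d e → Adj G e a → ⊥
    no-pentagon 6≤g {a} {b} {c} {d} {e} ab bc cd de ea =
      <⇒≱ 6≤g (girth 4 (cycle a (b ∷ c ∷ d ∷ e ∷ []) (s≤s (s≤s z≤n)) distinct
                              (ab ∷ bc ∷ cd ∷ de ∷ [-]) ea))
      where
      triangle-free : ∀ {x y z} → Adj G x y → Adj G y z → Adj G z x → ⊥
      triangle-free = no-triangle (≤-trans (m≤m+n 4 2) 6≤g)
      distinct : Unique (a ∷ b ∷ c ∷ d ∷ e ∷ [])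
      distinct = (Adj⇒≢ ab ∷ (λ { refl → triangle-free cd de ea })
                             ∷ (λ { refl → triangle-free ab bc cd }) ∷ (Adj⇒≢ ea ∘ sym) ∷ [])
               ∷ (Adj⇒≢ bc ∷ (λ { refl → triangle-free ab de ea })
                             ∷ (λ { refl → triangle-free bc cd de }) ∷ [])
               ∷ (Adj⇒≢ cd ∷ (λ { refl → triangle-free ab bc ea }) ∷ [])
               ∷ (Adj⇒≢ de ∷ [])
               ∷ [] ∷ []

    far-neighbour : 5 ≤ g → ∀ {p q x} → Adj G p q → Adj G p x → x ≢ q → 2 ≤ deg G x →
                    ∃[ w ] (w ≢ p × Adj G x w × ¬ EdgeNeighbour p q w)
    far-neighbour 5≤g {p} {q} {x} pq px x≢q 2≤deg with another-neighbour x p 2≤deg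
    ... | w , w≢p , xw = w , w≢p , xw , λ
      { (inj₁ (pw , _)) → no-triangle (≤-trans (n≤1+n 4) 5≤g) px xw (Adj-sym pw)
      ; (inj₂ (qw , _)) → no-square 5≤g (w≢p ∘ sym) x≢q px xw (Adj-sym qw) (Adj-sym pq)
      }

module AroundEdge {n : ℕ} (G : Graph n) (girth : GirthAtLeast G 6) (deg≥2 : ∀ x → 2 ≤ deg G x)
                  {v u : Fin n} (vu : Adj G v u) where

  E : Fin n → Fin n → Bool
  E = Graph.E G

  Near : Fin n → Set
  Near = EdgeNeighbour G v u

  zone : Bool → Bool → Bool → Bool → Bool
  zone a b p q = (a ∧ not p) ∨ (b ∧ not q)

  -- S is the Boolean form of Near = N(v) ∪ N(u) ∖ {u, v}, the vertices labelled 0.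
  S : Fin n → Bool
  S x = zone (E v x) (E u x) (does (x ≟ u)) (does (x ≟ v))

  -- Position (v ~ x) (u ~ x) (x = u) (x = v): in a triangle-free graph only five cases occur.
  data Position : Bool → Bool → Bool → Bool → Set where
    at-u   : Position true  false true  false
    at-v   : Position false true  false true
    near-v : Position true  false false false
    near-u : Position false true  false false
    far    : Position false false false false

  position : ∀ x → Position (E v x) (E u x) (does (x ≟ u)) (does (x ≟ v))
  position x with E v x in vx | E u x in ux | x ≟ u | x ≟ v
  ... | true  | true  | _        | _        =
    ⊥-elim (no-triangle G girth (m≤m+n 4 2) vx (Adj-sym G ux) (Adj-sym G vu))
  ... | true  | false | yes refl | no _     = at-u
  ... | true  | false | _        | yes refl = ⊥-elim (Adj⇒≢ G vx refl)
  ... | true  | false | no _     | no _     = near-v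
  ... | false | true  | no _     | yes refl = at-v
  ... | false | true  | yes refl | _        = ⊥-elim (Adj⇒≢ G ux refl)
  ... | false | true  | no _     | no _     = near-u
  ... | false | false | yes refl | _        = contradiction (trans (sym vu) vx) λ ()
  ... | false | false | no _     | yes refl = contradiction (trans (sym (Adj-sym G vu)) ux) λ ()
  ... | false | false | no _     | no _     = far

  count-at : ∀ {a b p q} → Position a b p q →
             toℕ (χᶜ (zone a b p q)) + ⟦ a ⟧ + ⟦ b ⟧ ≡ 1 + ⟦ p ⟧ + ⟦ q ⟧
  count-at at-u   = refl
  count-at at-v   = refl
  count-at near-v = refl
  count-at near-u = refl
  count-at far    = refl

  zone-at : ∀ {a b p q} → Position a b p q → zone a b p q ≡ true →
            (a ≡ true × p ≡ false) ⊎ (b ≡ true × q ≡ false)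
  zone-at near-v _ = inj₁ (refl , refl)
  zone-at near-u _ = inj₂ (refl , refl)

  S⇒Near : ∀ {x} → S x ≡ true → Near x
  S⇒Near {x} sx with zone-at (position x) sx
  ... | inj₁ (vx , x≢u) = inj₁ (vx , does≡false⇒¬ (x ≟ u) x≢u)
  ... | inj₂ (ux , x≢v) = inj₂ (ux , does≡false⇒¬ (x ≟ v) x≢v)

  ¬Near⇒¬S : ∀ {x} → ¬ Near x → S x ≡ false
  ¬Near⇒¬S ¬near = ¬-not (¬near ∘ S⇒Near)

  ¬Near-v : ¬ Near v
  ¬Near-v (inj₁ (vv , _))  = Adj⇒≢ G vv refl
  ¬Near-v (inj₂ (_ , v≢v)) = v≢v refl

  ¬Near-u : ¬ Near u
  ¬Near-u (inj₁ (_ , u≢u)) = u≢u refl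
  ¬Near-u (inj₂ (uu , _))  = Adj⇒≢ G uu refl

  two-outside-neighbours : ∀ x → S x ≡ true →
    ∃[ a ] ∃[ b ] (a ≢ b × Adj G x a × Adj G x b × S a ≡ false × S b ≡ false)
  two-outside-neighbours x sx with S⇒Near sx
  ... | inj₁ (vx , x≢u) =
    let w , w≢v , xw , ¬near = far-neighbour G girth (n≤1+n 5) vu vx x≢u (deg≥2 x)
    in v , w , w≢v ∘ sym , Adj-sym G vx , xw , ¬Near⇒¬S ¬Near-v , ¬Near⇒¬S ¬near
  ... | inj₂ (ux , x≢v) =
    let w , w≢u , xw , ¬near = far-neighbour G girth (n≤1+n 5) (Adj-sym G vu) ux x≢v (deg≥2 x)
    in u , w , w≢u ∘ sym , Adj-sym G ux , xw , ¬Near⇒¬S ¬Near-u , ¬Near⇒¬S (¬near ∘ Sum.swap)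

  ¬two-Near-neighbours : ∀ {x a b} → x ≢ v → x ≢ u → a ≢ b →
                         Adj G x a → Adj G x b → Near a → Near b → ⊥
  ¬two-Near-neighbours x≢v _ a≢b xa xb (inj₁ (va , _)) (inj₁ (vb , _)) =
    no-square G girth (n≤1+n 5) x≢v a≢b xa (Adj-sym G va) vb (Adj-sym G xb)
  ¬two-Near-neighbours _ _ _ xa xb (inj₁ (va , _)) (inj₂ (ub , _)) =
    no-pentagon G girth ≤-refl xa (Adj-sym G va) vu ub (Adj-sym G xb)
  ¬two-Near-neighbours _ _ _ xa xb (inj₂ (ua , _)) (inj₁ (vb , _)) =
    no-pentagon G girth ≤-refl xa (Adj-sym G ua) (Adj-sym G vu) vb (Adj-sym G xb)
  ¬two-Near-neighbours _ x≢u a≢b xa xb (inj₂ (ua , _)) (inj₂ (ub , _)) =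
    no-square G girth (n≤1+n 5) x≢u a≢b xa (Adj-sym G ua) ub (Adj-sym G xb)

  outside-neighbour : ∀ x → ∃[ y ] (Adj G x y × S y ≡ false)
  outside-neighbour x with x ≟ v | x ≟ u
  ... | yes refl | _        = u , vu , ¬Near⇒¬S ¬Near-u
  ... | no _     | yes refl = v , Adj-sym G vu , ¬Near⇒¬S ¬Near-v
  ... | no x≢v   | no x≢u
    with another-neighbour G x x (deg≥2 x)
  ... | a , _ , xa with S a in sa
  ...   | false = a , xa , sa
  ...   | true with another-neighbour G x a (deg≥2 x)
  ...     | b , b≢a , xb with S b in sb
  ...       | false = b , xb , sb
  ...       | true  = ⊥-elim (¬two-Near-neighbours x≢v x≢u (b≢a ∘ sym) xa xb (S⇒Near sa) (S⇒Near sb))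

  weight+degrees : weight G (χᶜ ∘ S) + (deg G v + deg G u) ≡ n + 2
  weight+degrees = begin
    weight G (χᶜ ∘ S) + (deg G v + deg G u)
      ≡⟨ sym (+-assoc (weight G (χᶜ ∘ S)) _ _) ⟩
    weight G (χᶜ ∘ S) + deg G v + deg G u
      ≡⟨ sym (∑-+-+ (toℕ ∘ χᶜ ∘ S) (λ x → ⟦ E v x ⟧) (λ x → ⟦ E u x ⟧)) ⟩
    ∑ (λ x → toℕ (χᶜ (S x)) + ⟦ E v x ⟧ + ⟦ E u x ⟧)
      ≡⟨ ∑-cong (λ x → count-at (position x)) ⟩
    ∑ (λ x → 1 + ⟦ does (x ≟ u) ⟧ + ⟦ does (x ≟ v) ⟧)
      ≡⟨ ∑-+-+ {n} (λ _ → 1) (λ x → ⟦ does (x ≟ u) ⟧) (λ x → ⟦ does (x ≟ v) ⟧) ⟩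
    ∑ {n} (λ _ → 1) + ∑ (λ x → ⟦ does (x ≟ u) ⟧) + ∑ (λ x → ⟦ does (x ≟ v) ⟧)
      ≡⟨ cong₂ _+_ (cong₂ _+_ (trans (∑-const n 1) (*-identityʳ n)) (∑-δ u)) (∑-δ v) ⟩
    n + 1 + 1
      ≡⟨ +-assoc n 1 1 ⟩
    n + 2 ∎
    where open ≡-Reasoning

  isTR2DF : IsTR2DF G (χᶜ ∘ S)
  isTR2DF = χᶜ-isTR2DF G S two-outside-neighbours (λ x _ → outside-neighbour x)

  γtR2≤n+2∸degrees : ∀ {Δ δ} → deg G v ≡ Δ → δ ≤ deg G u → γtR2≤ G (n + 2 ∸ (Δ + δ))
  γtR2≤n+2∸degrees {Δ} {δ} refl δ≤deg = χᶜ ∘ S , isTR2DF , m+n≤o⇒m≤o∸n (weight G (χᶜ ∘ S)) (begin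
    weight G (χᶜ ∘ S) + (Δ + δ)         ≤⟨ +-monoʳ-≤ (weight G (χᶜ ∘ S)) (+-monoʳ-≤ Δ δ≤deg) ⟩
    weight G (χᶜ ∘ S) + (Δ + deg G u)   ≡⟨ weight+degrees ⟩
    n + 2                               ∎)
    where open ≤-Reasoning

mainTheorem13 : (n : ℕ) (G : Graph n) (δ Δ : ℕ) →
    2 ≤ n → Connected G → GirthAtLeast G 6 →
    IsMinDegree G δ → 2 ≤ δ → IsMaxDegree G Δ →
    γtR2≤ G (n + 2 ∸ (Δ + δ))
mainTheorem13 n G δ Δ _ _ girth (_ , δ≤deg) 2≤δ ((v , deg-v≡Δ) , _)
  with another-neighbour G v v (≤-trans 2≤δ (δ≤deg v))
... | u , _ , vu =
  AroundEdge.γtR2≤n+2∸degrees G girth (λ x → ≤-trans 2≤δ (δ≤deg x)) vu deg-v≡Δ (δ≤deg u)
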